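{- For every positive integer $n$, $P(n,2) = \dfrac{n!}{2^{\lfloor n/2\rfloor}}$.
   Context: A permutation on $\{1,\dots,n\}$ is a sequence $(\sigma(1),\dots,\sigma(n))$ listing each element of $\{1,\dots,n\}$ exactly once. The Chebyshev distance between permutations $\sigma,\pi$ is $\max_{1\le i\le n}|\sigma(i)-\pi(i)|$. $P(n,d)$ denotes the maximum cardinality of a set of permutations on $\{1,\dots,n\}$ in which any two distinct permutations have Chebyshev distance at least $d$. -}

module Defs where

open import Data.Nat using (ℕ; _⊔_; _≤_; ∣_-_∣)
open import Data.Fin using (Fin; toℕ; zero; suc)
open import Relation.Binary.PropositionalEquality using (_≡_)
open import Data.Fin.Permutation using (Permutation′; _⟨$⟩ʳ_)
open import Data.List using (List; length)
open import Data.List.Relation.Unary.AllPairs using (AllPairs)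
open import Data.Product using (Σ; _×_)

maxFin : (n : ℕ) → (Fin n → ℕ) → ℕ
maxFin ℕ.zero    f = 0
maxFin (ℕ.suc n) f = f zero ⊔ maxFin n (λ i → f (suc i))

chebyshev : {n : ℕ} → Permutation′ n → Permutation′ n → ℕ
chebyshev {n} σ π = maxFin n (λ i → ∣ toℕ (σ ⟨$⟩ʳ i) - toℕ (π ⟨$⟩ʳ i) ∣)

IsCode : (n d : ℕ) → List (Permutation′ n) → Set
IsCode n d C = AllPairs (λ σ π → d ≤ chebyshev σ π) C

IsP : (n d m : ℕ) → Set
IsP n d m =
  Σ (List (Permutation′ n)) (λ C → IsCode n d C × length C ≡ m)
  × ((C : List (Permutation′ n)) → IsCode n d C → length C ≤ m)

-- Upper bound: group the values into pairs {2k, 2k+1}, k < ⌊n/2⌋, and let τ range over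
-- the 2^⌊n/2⌋ involutions of the values that exchange some of these pairs.  If
-- τ ∘ σ = τ′ ∘ σ′ then σ(i) and σ′(i) lie in the same pair for every i, so σ and σ′
-- are at distance at most 1.  Hence the translates of the words of a code are pairwise
-- disjoint and |C| · 2^⌊n/2⌋ ≤ n!.
--
-- Lower bound: colour σ by the ⌊n/2⌋ bits "parity of the number of inversions among
-- the positions of the values 2k, 2k+1, 2k+2".  If σ ≠ π are at distance 1, then
-- t = π ∘ σ⁻¹ moves every value by at most one, so it is a product of disjoint
-- transpositions of adjacent values.  Starting from the largest transposed pair and
-- walking down a chain of transposed pairs, one reaches a window {2k, 2k+1, 2k+2} on
-- which t acts as a single transposition, so the k-th bits of σ and π differ.  Every
-- colour class is therefore a code, and one of them has at least n!/2^⌊n/2⌋ elements.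

module Submission where

open import Defs
open import Data.Nat using (ℕ; suc; _/_; _^_; _!)
open import Data.Nat.Properties using (m^n≢0)

open import Algebra.Properties.CommutativeSemigroup Data.Nat.Properties.+-commutativeSemigroup
  using (interchange)
open import Data.Bool.Base using (Bool; true; false; not; _xor_; if_then_else_)
open import Data.Bool.Properties using (xor-comm; not-distribˡ-xor; not-¬)
open import Data.Empty using (⊥-elim)
open import Data.Fin.Base as Fin
  using (Fin; toℕ; fromℕ<; punchIn; punchOut; combine; remQuot; funToFin; finToFun)
open import Data.Fin.Patterns using (0F; 1F)
open import Data.Fin.Permutation as Perm
  using (Permutation′; _⟨$⟩ʳ_; _⟨$⟩ˡ_; _∘ₚ_; flip; insert; remove)
open import Data.Fin.Properties
  using ( _≟_; any?; toℕ-injective; toℕ-fromℕ<; fromℕ<-toℕ; toℕ<n; punchOut-cong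
        ; combine-injective; combine-remQuot; funToFin-finToFin; finToFun-funToFin
        ; injective⇒≤; 2↔Bool )
open import Data.List.Base using (List; []; _∷_; length; lookup; map; filter; take; allFin)
open import Data.List.Membership.Propositional.Properties using (∈-lookup)
open import Data.List.Properties using (length-map; length-take; length-tabulate)
import Data.List.Relation.Unary.All as All
open import Data.List.Relation.Unary.All using (All; []; _∷_)
open import Data.List.Relation.Unary.All.Properties using (all-filter)
open import Data.List.Relation.Unary.AllPairs using (AllPairs; []; _∷_)
import Data.List.Relation.Unary.AllPairs.Properties as AllPairs
open import Data.List.Relation.Unary.Unique.Propositional.Properties using (allFin⁺)
open import Data.Nat.Base
  using (zero; _+_; _*_; _≤_; _<_; _⊓_; _⊔_; _<ᵇ_; z≤n; s≤s; ∣_-_∣; ⌊_/2⌋; NonZero; >-nonZero⁻¹)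
open import Data.Nat.DivMod using (m*n/n≡m; /-monoˡ-≤; m/n*n≤m)
open import Data.Nat.Properties
  using ( _≤?_; _<?_; ≤-refl; ≤-trans; <⇒≤; <-≤-trans; ≤-pred; n≤1+n; ≰⇒>; ≮⇒≥; <⇒≱; n≮n
        ; m≤n⇒m<n∨m≡n; suc-injective; 1+n≢n; m+1+n≢n; +-mono-≤; +-monoˡ-≤; *-comm
        ; *-identityʳ; *-zeroʳ; m≤m⊔n; m≤n⊔m; ⊔-lub; m≤n⇒m⊓n≡m; ∣-∣-comm; ∣n-n∣≡0
        ; module ≤-Reasoning )
  renaming (_≟_ to _≟ℕ_)
open import Data.Product using (∃; _×_; _,_; proj₁; proj₂; uncurry)
import Data.Product as Product
open import Data.Sum using (_⊎_; inj₁; inj₂)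
import Data.Sum as Sum
open import Function using (id; _∘_)
open import Function.Bundles using (Inverse)
open import Function.Definitions using (Injective)
open import Relation.Binary.Definitions using (Symmetric)
open import Relation.Binary.PropositionalEquality
open import Relation.Nullary using (yes; no; does)

≤-maxFin : ∀ {n} (f : Fin n → ℕ) (i : Fin n) → f i ≤ maxFin n f
≤-maxFin f 0F          = m≤m⊔n (f 0F) _
≤-maxFin f (Fin.suc i) = ≤-trans (≤-maxFin (f ∘ Fin.suc) i) (m≤n⊔m (f 0F) _)

maxFin-least : ∀ {n k} (f : Fin n → ℕ) → (∀ i → f i ≤ k) → maxFin n f ≤ k
maxFin-least {zero}  f _   = z≤n
maxFin-least {suc n} f f≤k = ⊔-lub (f≤k 0F) (maxFin-least (f ∘ Fin.suc) (f≤k ∘ Fin.suc))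

maxFin-cong : ∀ {n} {f g : Fin n → ℕ} → f ≗ g → maxFin n f ≡ maxFin n g
maxFin-cong {zero}  f≗g = refl
maxFin-cong {suc n} f≗g = cong₂ _⊔_ (f≗g 0F) (maxFin-cong (f≗g ∘ Fin.suc))

chebyshev-comm : ∀ {n} (σ π : Permutation′ n) → chebyshev σ π ≡ chebyshev π σ
chebyshev-comm σ π = maxFin-cong (λ i → ∣-∣-comm (toℕ (σ ⟨$⟩ʳ i)) (toℕ (π ⟨$⟩ʳ i)))

chebyshev-sym : ∀ {n d} (σ π : Permutation′ n) → d ≤ chebyshev σ π → d ≤ chebyshev π σ
chebyshev-sym {d = d} σ π = subst (d ≤_) (chebyshev-comm σ π)

≤-chebyshev : ∀ {n} (σ π : Permutation′ n) i → ∣ toℕ (σ ⟨$⟩ʳ i) - toℕ (π ⟨$⟩ʳ i) ∣ ≤ chebyshev σ π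
≤-chebyshev σ π = ≤-maxFin _

-- The Lehmer code

encode : ∀ {n} → Permutation′ n → Fin (n !)
encode {zero}  π = 0F
encode {suc n} π = combine (π ⟨$⟩ʳ 0F) (encode (remove 0F π))

decode : ∀ {n} → Fin (n !) → Permutation′ n
decode {zero}  x = Perm.id
decode {suc n} x = uncurry (insert 0F) (Product.map₂ decode (remQuot (n !) x))

punchOut-cong₂ : ∀ {n} {i i′ j j′ : Fin (suc n)} {i≢j : i ≢ j} {i′≢j′ : i′ ≢ j′} →
                 i ≡ i′ → j ≡ j′ → punchOut i≢j ≡ punchOut i′≢j′
punchOut-cong₂ {i = i} refl refl = punchOut-cong i refl

remove-cong : ∀ {n} {σ π : Permutation′ (suc n)} → σ Perm.≈ π → remove 0F σ Perm.≈ remove 0F π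
remove-cong {σ = σ} {π} σ≈π j = punchOut-cong₂ (σ≈π 0F) (σ≈π (Fin.suc j))

encode-cong : ∀ {n} {σ π : Permutation′ n} → σ Perm.≈ π → encode σ ≡ encode π
encode-cong {zero}  σ≈π = refl
encode-cong {suc n} {σ} {π} σ≈π = cong₂ combine (σ≈π 0F) (encode-cong (remove-cong {σ = σ} {π} σ≈π))

encode-injective : ∀ {n} {σ π : Permutation′ n} → encode σ ≡ encode π → σ Perm.≈ π
encode-injective {suc n} {σ} {π} eq = pointwise
  where
  open ≡-Reasoning
  σ′ = remove 0F σ
  π′ = remove 0F π
  parts = combine-injective (σ ⟨$⟩ʳ 0F) (encode σ′) (π ⟨$⟩ʳ 0F) (encode π′) eq
  tails : σ′ Perm.≈ π′
  tails = encode-injective {n} {σ′} {π′} (proj₂ parts)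
  pointwise : σ Perm.≈ π
  pointwise 0F          = proj₁ parts
  pointwise (Fin.suc j) = begin
    σ ⟨$⟩ʳ Fin.suc j                          ≡⟨ Perm.insert-remove 0F σ (Fin.suc j) ⟨
    insert 0F (σ ⟨$⟩ʳ 0F) σ′ ⟨$⟩ʳ Fin.suc j   ≡⟨ Perm.insert-punchIn 0F _ σ′ j ⟩
    punchIn (σ ⟨$⟩ʳ 0F) (σ′ ⟨$⟩ʳ j)           ≡⟨ cong₂ punchIn (proj₁ parts) (tails j) ⟩
    punchIn (π ⟨$⟩ʳ 0F) (π′ ⟨$⟩ʳ j)           ≡⟨ Perm.insert-punchIn 0F _ π′ j ⟨
    insert 0F (π ⟨$⟩ʳ 0F) π′ ⟨$⟩ʳ Fin.suc j   ≡⟨ Perm.insert-remove 0F π (Fin.suc j) ⟩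
    π ⟨$⟩ʳ Fin.suc j                          ∎

encode-decode : ∀ {n} (x : Fin (n !)) → encode (decode {n} x) ≡ x
encode-decode {zero}  0F = refl
encode-decode {suc n} x  = begin
  combine j (encode (remove 0F (insert 0F j (decode y))))  ≡⟨ cong (combine j) (encode-cong {n} {π = decode y} removed) ⟩
  combine j (encode (decode {n} y))                        ≡⟨ cong (combine j) (encode-decode {n} y) ⟩
  combine j y                                              ≡⟨ combine-remQuot (n !) x ⟩
  x                                                        ∎
  where
  open ≡-Reasoning
  j = proj₁ (remQuot (n !) x)
  y = proj₂ (remQuot (n !) x)
  removed = Perm.remove-insert 0F j (decode y)

decode-injective : ∀ {n} {x y : Fin (n !)} → decode {n} x Perm.≈ decode y → x ≡ y
decode-injective {n} {x} {y} eq = begin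
  x                     ≡⟨ encode-decode {n} x ⟨
  encode {n} (decode x) ≡⟨ encode-cong {n} {decode x} {decode y} eq ⟩
  encode {n} (decode y) ≡⟨ encode-decode {n} y ⟩
  y                     ∎
  where open ≡-Reasoning

double : ℕ → ℕ
double zero    = zero
double (suc k) = suc (suc (double k))

double≡*2 : ∀ k → double k ≡ k * 2
double≡*2 zero    = refl
double≡*2 (suc k) = cong (suc ∘ suc) (double≡*2 k)

double≤⇒≤/2 : ∀ {k N} → double k ≤ N → k ≤ N / 2
double≤⇒≤/2 {k} {N} 2k≤N = subst (_≤ N / 2) (m*n/n≡m k 2) (/-monoˡ-≤ 2 (subst (_≤ N) (double≡*2 k) 2k≤N))

double[/2]≤ : ∀ N → double (N / 2) ≤ N
double[/2]≤ N = subst (_≤ N) (sym (double≡*2 (N / 2))) (m/n*n≤m N 2)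

⌊/2⌋≡⇒∣-∣≤1 : ∀ a b → ⌊ a /2⌋ ≡ ⌊ b /2⌋ → ∣ a - b ∣ ≤ 1
⌊/2⌋≡⇒∣-∣≤1 (suc (suc a)) (suc (suc b)) eq = ⌊/2⌋≡⇒∣-∣≤1 a b (suc-injective eq)
⌊/2⌋≡⇒∣-∣≤1 0             0             _  = z≤n
⌊/2⌋≡⇒∣-∣≤1 0             1             _  = ≤-refl
⌊/2⌋≡⇒∣-∣≤1 1             0             _  = ≤-refl
⌊/2⌋≡⇒∣-∣≤1 1             1             _  = z≤n
⌊/2⌋≡⇒∣-∣≤1 0             (suc (suc b)) ()
⌊/2⌋≡⇒∣-∣≤1 1             (suc (suc b)) ()
⌊/2⌋≡⇒∣-∣≤1 (suc (suc a)) 0             ()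
⌊/2⌋≡⇒∣-∣≤1 (suc (suc a)) 1             ()

-- Upper bound: translating a code by the involutions swapping value pairs {2k, 2k+1}

swapPair : Fin 2 → (ℕ → ℕ) → ℕ → ℕ
swapPair b  f (suc (suc v)) = suc (suc (f v))
swapPair 0F f 0             = 0
swapPair 0F f 1             = 1
swapPair 1F f 0             = 1
swapPair 1F f 1             = 0

swapPairs : (m : ℕ) → (Fin m → Fin 2) → ℕ → ℕ
swapPairs zero    s v = v
swapPairs (suc m) s   = swapPair (s 0F) (swapPairs m (s ∘ Fin.suc))

swapPairs-involutive : ∀ m s v → swapPairs m s (swapPairs m s v) ≡ v
swapPairs-involutive zero    s v = refl
swapPairs-involutive (suc m) s   = go (s 0F)
  where
  go : ∀ b v → swapPair b (swapPairs m (s ∘ Fin.suc)) (swapPair b (swapPairs m (s ∘ Fin.suc)) v) ≡ v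
  go b  (suc (suc v)) = cong (suc ∘ suc) (swapPairs-involutive m (s ∘ Fin.suc) v)
  go 0F 0             = refl
  go 0F 1             = refl
  go 1F 0             = refl
  go 1F 1             = refl

swapPairs-⌊/2⌋ : ∀ m s v → ⌊ swapPairs m s v /2⌋ ≡ ⌊ v /2⌋
swapPairs-⌊/2⌋ zero    s v = refl
swapPairs-⌊/2⌋ (suc m) s   = go (s 0F)
  where
  go : ∀ b v → ⌊ swapPair b (swapPairs m (s ∘ Fin.suc)) v /2⌋ ≡ ⌊ v /2⌋
  go b  (suc (suc v)) = cong suc (swapPairs-⌊/2⌋ m (s ∘ Fin.suc) v)
  go 0F 0             = refl
  go 0F 1             = refl
  go 1F 0             = refl
  go 1F 1             = refl

swapPairs-< : ∀ m s {N v} → double m ≤ N → v < N → swapPairs m s v < N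
swapPairs-< zero    s _ v<N = v<N
swapPairs-< (suc m) s {suc (suc N)} (s≤s (s≤s 2m≤N)) = go (s 0F)
  where
  go : ∀ b {v} → v < suc (suc N) → swapPair b (swapPairs m (s ∘ Fin.suc)) v < suc (suc N)
  go b  {suc (suc v)} (s≤s (s≤s v<N)) = s≤s (s≤s (swapPairs-< m (s ∘ Fin.suc) 2m≤N v<N))
  go 0F {0}           _               = s≤s z≤n
  go 0F {1}           _               = s≤s (s≤s z≤n)
  go 1F {0}           _               = s≤s (s≤s z≤n)
  go 1F {1}           _               = s≤s z≤n

swapPairs-injective : ∀ m {s s′} → (∀ v → v < double m → swapPairs m s v ≡ swapPairs m s′ v) → s ≗ s′
swapPairs-injective (suc m) {s} {s′} eq 0F          =
  toℕ-injective (trans (swapPair-0 (s 0F)) (trans (eq 0 (s≤s z≤n)) (sym (swapPair-0 (s′ 0F)))))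
  where
  swapPair-0 : ∀ b {f} → toℕ b ≡ swapPair b f 0
  swapPair-0 0F = refl
  swapPair-0 1F = refl
swapPairs-injective (suc m)          eq (Fin.suc k) =
  swapPairs-injective m (λ v v<2m → suc-injective (suc-injective (eq (suc (suc v)) (s≤s (s≤s v<2m))))) k

pairSwap : ∀ {N m} → double m ≤ N → (Fin m → Fin 2) → Permutation′ N
pairSwap {N} {m} 2m≤N s = Perm.permutation f f f∘f f∘f
  where
  f : Fin N → Fin N
  f i = fromℕ< (swapPairs-< m s 2m≤N (toℕ<n i))
  f∘f : ∀ i → f (f i) ≡ i
  f∘f i = toℕ-injective (begin
    toℕ (f (f i))                           ≡⟨ toℕ-fromℕ< _ ⟩
    swapPairs m s (toℕ (f i))               ≡⟨ cong (swapPairs m s) (toℕ-fromℕ< _) ⟩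
    swapPairs m s (swapPairs m s (toℕ i))   ≡⟨ swapPairs-involutive m s (toℕ i) ⟩
    toℕ i                                   ∎)
    where open ≡-Reasoning

toℕ-pairSwap : ∀ {N m} (2m≤N : double m ≤ N) s i → toℕ (pairSwap 2m≤N s ⟨$⟩ʳ i) ≡ swapPairs m s (toℕ i)
toℕ-pairSwap 2m≤N s i = toℕ-fromℕ< _

AllPairs-lookup : ∀ {A : Set} {R : A → A → Set} → Symmetric R → ∀ {xs} → AllPairs R xs →
                  ∀ {i j} → i ≢ j → R (lookup xs i) (lookup xs j)
AllPairs-lookup sym (r ∷ rs) {0F}        {0F}        i≢j = ⊥-elim (i≢j refl)
AllPairs-lookup sym (r ∷ rs) {0F}        {Fin.suc j} _   = All.lookup r (∈-lookup j)
AllPairs-lookup sym (r ∷ rs) {Fin.suc i} {0F}        _   = sym (All.lookup r (∈-lookup i))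
AllPairs-lookup sym (r ∷ rs) {Fin.suc i} {Fin.suc j} i≢j = AllPairs-lookup sym rs (i≢j ∘ cong Fin.suc)

funToFin-cong : ∀ {m n} {f g : Fin m → Fin n} → f ≗ g → funToFin f ≡ funToFin g
funToFin-cong {zero}  f≗g = refl
funToFin-cong {suc m} f≗g = cong₂ combine (f≗g 0F) (funToFin-cong (f≗g ∘ Fin.suc))

finToFun-injective : ∀ {m n} {x y : Fin (n ^ m)} → finToFun x ≗ finToFun y → x ≡ y
finToFun-injective {m} {n} {x} {y} eq =
  trans (sym (funToFin-finToFin {m} {n} x)) (trans (funToFin-cong {m} {n} eq) (funToFin-finToFin {m} {n} y))

module _ {N m} (2m≤N : double m ≤ N) {C : List (Permutation′ N)} (code : IsCode N 2 C) where

  translate : Fin (length C) × Fin (2 ^ m) → Permutation′ N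
  translate (c , b) = lookup C c ∘ₚ pairSwap 2m≤N (finToFun b)

  private
    swapped-agree : ∀ {c c′ b b′} → translate (c , b) Perm.≈ translate (c′ , b′) → ∀ i →
                    swapPairs m (finToFun b) (toℕ (lookup C c ⟨$⟩ʳ i)) ≡
                    swapPairs m (finToFun b′) (toℕ (lookup C c′ ⟨$⟩ʳ i))
    swapped-agree {b = b} {b′} eq i =
      trans (sym (toℕ-pairSwap 2m≤N (finToFun b) _)) (trans (cong toℕ (eq i)) (toℕ-pairSwap 2m≤N (finToFun b′) _))

    translate-close : ∀ {c c′ b b′} → translate (c , b) Perm.≈ translate (c′ , b′) →
                      chebyshev (lookup C c) (lookup C c′) ≤ 1
    translate-close {c} {c′} {b} {b′} eq = maxFin-least _ λ i → ⌊/2⌋≡⇒∣-∣≤1 _ _ (begin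
        ⌊ toℕ (lookup C c ⟨$⟩ʳ i) /2⌋                               ≡⟨ swapPairs-⌊/2⌋ m (finToFun b) _ ⟨
        ⌊ swapPairs m (finToFun b) (toℕ (lookup C c ⟨$⟩ʳ i)) /2⌋     ≡⟨ cong ⌊_/2⌋ (swapped-agree eq i) ⟩
        ⌊ swapPairs m (finToFun b′) (toℕ (lookup C c′ ⟨$⟩ʳ i)) /2⌋   ≡⟨ swapPairs-⌊/2⌋ m (finToFun b′) _ ⟩
        ⌊ toℕ (lookup C c′ ⟨$⟩ʳ i) /2⌋                              ∎)
      where open ≡-Reasoning

    translate-injectiveʳ : ∀ {c b b′} → translate (c , b) Perm.≈ translate (c , b′) → b ≡ b′
    translate-injectiveʳ {c} {b} {b′} eq = finToFun-injective {m} {2} (swapPairs-injective m agree)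
      where
      σ = lookup C c
      agree : ∀ v → v < double m → swapPairs m (finToFun b) v ≡ swapPairs m (finToFun b′) v
      agree v v<2m =
        subst (λ u → swapPairs m (finToFun b) u ≡ swapPairs m (finToFun b′) u) σσ⁻¹v (swapped-agree eq _)
        where
        v<N = <-≤-trans v<2m 2m≤N
        σσ⁻¹v : toℕ (σ ⟨$⟩ʳ (σ ⟨$⟩ˡ fromℕ< v<N)) ≡ v
        σσ⁻¹v = trans (cong toℕ (Perm.inverseʳ σ)) (toℕ-fromℕ< v<N)

  translate-injective : ∀ {p q} → translate p Perm.≈ translate q → p ≡ q
  translate-injective {c , b} {c′ , b′} eq with c ≟ c′
  ... | yes refl = cong (c ,_) (translate-injectiveʳ eq)
  ... | no c≢c′  = ⊥-elim (<⇒≱ (s≤s (translate-close eq)) far)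
    where
    far = AllPairs-lookup {R = λ σ π → 2 ≤ chebyshev σ π} (λ {σ} {π} → chebyshev-sym σ π) code c≢c′

  length*2^m≤! : length C * 2 ^ m ≤ N !
  length*2^m≤! = injective⇒≤ {f = encode ∘ translate ∘ remQuot (2 ^ m)} λ {x} {y} eq → begin
    x                              ≡⟨ combine-remQuot {L} (2 ^ m) x ⟨
    uncurry combine (remQuot′ x)   ≡⟨ cong (uncurry combine) (translate-injective (encode-injective eq)) ⟩
    uncurry combine (remQuot′ y)   ≡⟨ combine-remQuot {L} (2 ^ m) y ⟩
    y                              ∎
    where
    open ≡-Reasoning
    L = length C
    remQuot′ : Fin (L * 2 ^ m) → Fin L × Fin (2 ^ m)
    remQuot′ = remQuot (2 ^ m)

-- Permutations of Fin N as bijections of ℕ fixing every v ≥ N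

module _ {N : ℕ} where

  toℕ-or-≥ : ∀ v → (∃ λ (i : Fin N) → toℕ i ≡ v) ⊎ N ≤ v
  toℕ-or-≥ v with v <? N
  ... | yes v<N = inj₁ (fromℕ< v<N , toℕ-fromℕ< v<N)
  ... | no  v≮N = inj₂ (≮⇒≥ v≮N)

  extend : Permutation′ N → ℕ → ℕ
  extend ρ v with v <? N
  ... | yes v<N = toℕ (ρ ⟨$⟩ʳ fromℕ< v<N)
  ... | no  _   = v

  extend-toℕ : ∀ ρ i → extend ρ (toℕ i) ≡ toℕ (ρ ⟨$⟩ʳ i)
  extend-toℕ ρ i with toℕ i <? N
  ... | yes i<N = cong (toℕ ∘ (ρ ⟨$⟩ʳ_)) (fromℕ<-toℕ i i<N)
  ... | no  i≮N = ⊥-elim (i≮N (toℕ<n i))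

  extend-≥ : ∀ ρ {v} → N ≤ v → extend ρ v ≡ v
  extend-≥ ρ {v} N≤v with v <? N
  ... | yes v<N = ⊥-elim (<⇒≱ v<N N≤v)
  ... | no  _   = refl

  extend-flip-extend : ∀ ρ v → extend (flip ρ) (extend ρ v) ≡ v
  extend-flip-extend ρ v with toℕ-or-≥ v
  ... | inj₁ (i , refl) = begin
    extend (flip ρ) (extend ρ (toℕ i))   ≡⟨ cong (extend (flip ρ)) (extend-toℕ ρ i) ⟩
    extend (flip ρ) (toℕ (ρ ⟨$⟩ʳ i))     ≡⟨ extend-toℕ (flip ρ) _ ⟩
    toℕ (ρ ⟨$⟩ˡ (ρ ⟨$⟩ʳ i))              ≡⟨ cong toℕ (Perm.inverseˡ ρ) ⟩
    toℕ i                                ∎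
    where open ≡-Reasoning
  ... | inj₂ N≤v = trans (cong (extend (flip ρ)) (extend-≥ ρ N≤v)) (extend-≥ (flip ρ) N≤v)

  extend-extend-flip : ∀ ρ v → extend ρ (extend (flip ρ) v) ≡ v
  extend-extend-flip ρ = extend-flip-extend (flip ρ)

-- Lower bound: a colouring that separates permutations at distance one

<ᵇ-flip : ∀ {a b} → a ≢ b → (b <ᵇ a) ≡ not (a <ᵇ b)
<ᵇ-flip {zero}  {zero}  a≢b = ⊥-elim (a≢b refl)
<ᵇ-flip {zero}  {suc b} _   = refl
<ᵇ-flip {suc a} {zero}  _   = refl
<ᵇ-flip {suc a} {suc b} a≢b = <ᵇ-flip (a≢b ∘ cong suc)

inversionParity : ℕ → ℕ → ℕ → Bool
inversionParity a b c = (b <ᵇ a) xor (c <ᵇ a) xor (c <ᵇ b)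

inversionParity-swap₁₂ : ∀ {a b} c → a ≢ b → inversionParity b a c ≡ not (inversionParity a b c)
inversionParity-swap₁₂ {a} {b} c a≢b = begin
  (a <ᵇ b) xor (c <ᵇ b) xor (c <ᵇ a)        ≡⟨ cong₂ _xor_ (<ᵇ-flip (a≢b ∘ sym)) (xor-comm (c <ᵇ b) (c <ᵇ a)) ⟩
  not (b <ᵇ a) xor (c <ᵇ a) xor (c <ᵇ b)    ≡⟨ not-distribˡ-xor (b <ᵇ a) _ ⟨
  not (inversionParity a b c)               ∎
  where open ≡-Reasoning

inversionParity-swap₂₃ : ∀ a {b c} → b ≢ c → inversionParity a c b ≡ not (inversionParity a b c)
inversionParity-swap₂₃ a {b} {c} b≢c = begin
  (c <ᵇ a) xor (b <ᵇ a) xor (b <ᵇ c)        ≡⟨ cong (λ x → (c <ᵇ a) xor (b <ᵇ a) xor x) (<ᵇ-flip (b≢c ∘ sym)) ⟩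
  (c <ᵇ a) xor (b <ᵇ a) xor not (c <ᵇ b)    ≡⟨ bool-identity (b <ᵇ a) (c <ᵇ a) (c <ᵇ b) ⟩
  not (inversionParity a b c)               ∎
  where
  open ≡-Reasoning
  bool-identity : ∀ x y z → y xor x xor not z ≡ not (x xor y xor z)
  bool-identity false false z = refl
  bool-identity false true  z = refl
  bool-identity true  false z = refl
  bool-identity true  true  z = refl

windowParity : (ℕ → ℕ) → ℕ → Bool
windowParity R k = inversionParity (R (double k)) (R (suc (double k))) (R (double (suc k)))

module _ {P Q : ℕ → ℕ} (Q-injective : Injective _≡_ _≡_ Q) (k : ℕ) where

  windowParity-swap₀₁ : P (double k) ≡ Q (suc (double k)) → P (suc (double k)) ≡ Q (double k) →
                        P (double (suc k)) ≡ Q (double (suc k)) → windowParity P k ≡ not (windowParity Q k)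
  windowParity-swap₀₁ e₀ e₁ e₂ rewrite e₀ | e₁ | e₂ =
    inversionParity-swap₁₂ _ (1+n≢n ∘ sym ∘ Q-injective)

  windowParity-swap₁₂ : P (double k) ≡ Q (double k) → P (suc (double k)) ≡ Q (double (suc k)) →
                        P (double (suc k)) ≡ Q (suc (double k)) → windowParity P k ≡ not (windowParity Q k)
  windowParity-swap₁₂ e₀ e₁ e₂ rewrite e₀ | e₁ | e₂ =
    inversionParity-swap₂₃ (Q (double k)) (1+n≢n ∘ sym ∘ Q-injective)

∣-∣≤1⇒ : ∀ {a b} → ∣ a - b ∣ ≤ 1 → a ≡ b ⊎ a ≡ suc b ⊎ suc a ≡ b
∣-∣≤1⇒ {zero}        {zero}        _ = inj₁ refl
∣-∣≤1⇒ {zero}        {suc zero}    _ = inj₂ (inj₂ refl)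
∣-∣≤1⇒ {suc zero}    {zero}        _ = inj₂ (inj₁ refl)
∣-∣≤1⇒ {suc a}       {suc b}       d = Sum.map (cong suc) (Sum.map (cong suc) (cong suc)) (∣-∣≤1⇒ d)
∣-∣≤1⇒ {zero}        {suc (suc b)} (s≤s ())
∣-∣≤1⇒ {suc (suc a)} {zero}        (s≤s ())

even-or-odd : ∀ n → (∃ λ k → n ≡ double k) ⊎ (∃ λ k → n ≡ suc (double k))
even-or-odd zero          = inj₁ (0 , refl)
even-or-odd (suc zero)    = inj₂ (0 , refl)
even-or-odd (suc (suc n)) = Sum.map (Product.map suc (cong (suc ∘ suc))) (Product.map suc (cong (suc ∘ suc)))
                                    (even-or-odd n)

module _ {N : ℕ} {t s : ℕ → ℕ} (t∘s : ∀ v → t (s v) ≡ v) (s∘t : ∀ v → s (t v) ≡ v)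
         (t-near : ∀ v → ∣ t v - v ∣ ≤ 1) (t-fixes : ∀ {v} → N ≤ v → t v ≡ v) where

  private
    t-injective : ∀ {u v} → t u ≡ t v → u ≡ v
    t-injective {u} {v} e = trans (sym (s∘t u)) (trans (cong s e) (s∘t v))

    t-preimage : ∀ {v u} → s v ≡ u → t u ≡ v
    t-preimage {v} e = subst (λ u → t u ≡ _) e (t∘s v)

    near : ∀ v → t v ≡ v ⊎ t v ≡ suc v ⊎ suc (t v) ≡ v
    near v = ∣-∣≤1⇒ (t-near v)

    s-near : ∀ v → s v ≡ v ⊎ suc (s v) ≡ v ⊎ s v ≡ suc v
    s-near v with near (s v)
    ... | inj₁ e        = inj₁ (trans (sym e) (t∘s v))
    ... | inj₂ (inj₁ e) = inj₂ (inj₁ (trans (sym e) (t∘s v)))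
    ... | inj₂ (inj₂ e) = inj₂ (inj₂ (trans (sym e) (cong suc (t∘s v))))

    swap-partner : ∀ {p} → t (suc p) ≡ p → t (suc (suc p)) ≢ suc p → t p ≡ suc p
    swap-partner {p} t[1+p]≡p t[2+p]≢1+p with s-near (suc p)
    ... | inj₁ e        = ⊥-elim (1+n≢n (trans (sym (t-preimage e)) t[1+p]≡p))
    ... | inj₂ (inj₁ e) = t-preimage (suc-injective e)
    ... | inj₂ (inj₂ e) = ⊥-elim (t[2+p]≢1+p (t-preimage e))

    moved⇒<N : ∀ {w} → t w ≢ w → w < N
    moved⇒<N t[w]≢w = ≰⇒> (t[w]≢w ∘ t-fixes)

    largest-moved : ∀ d → (∀ {v} → d ≤ v → t v ≡ v) →
                    (∀ v → t v ≡ v) ⊎ ∃ λ w → t w ≢ w × (∀ {v} → w < v → t v ≡ v)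
    largest-moved zero    fixed = inj₁ (λ v → fixed z≤n)
    largest-moved (suc d) fixed with t d ≟ℕ d
    ... | no  t[d]≢d = inj₂ (d , t[d]≢d , fixed)
    ... | yes t[d]≡d = largest-moved d fixed′
      where
      fixed′ : ∀ {v} → d ≤ v → t v ≡ v
      fixed′ d≤v with m≤n⇒m<n∨m≡n d≤v
      ... | inj₁ d<v  = fixed d<v
      ... | inj₂ refl = t[d]≡d

    largest-moved-swaps : ∀ {w} → t w ≢ w → (∀ {v} → w < v → t v ≡ v) →
                          ∃ λ p → w ≡ suc p × t (suc p) ≡ p × t p ≡ suc p
    largest-moved-swaps {w} t[w]≢w fixed with near w
    ... | inj₁ t[w]≡w          = ⊥-elim (t[w]≢w t[w]≡w)
    ... | inj₂ (inj₁ t[w]≡1+w) = ⊥-elim (1+n≢n (sym (t-injective (trans t[w]≡1+w (sym (fixed ≤-refl))))))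
    ... | inj₂ (inj₂ 1+t[w]≡w) = t w , sym 1+t[w]≡w , t[1+p]≡p , swap-partner t[1+p]≡p t[2+p]≢1+p
      where
      t[1+p]≡p = cong t 1+t[w]≡w
      t[2+p]≢1+p : t (suc (suc (t w))) ≢ suc (t w)
      t[2+p]≢1+p e = 1+n≢n (trans (sym (fixed (subst (_< suc (suc (t w))) 1+t[w]≡w ≤-refl))) e)

  module _ {P Q : ℕ → ℕ} (Q-injective : Injective _≡_ _≡_ Q) (P≗Q∘t : ∀ v → P v ≡ Q (t v)) where

    WindowFlips : Set
    WindowFlips = ∃ λ k → double (suc k) ≤ N × windowParity P k ≡ not (windowParity Q k)

    private
      via-t : ∀ {u v} → t u ≡ v → P u ≡ Q v
      via-t e = trans (P≗Q∘t _) (cong Q e)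

      -- t exchanges 2k+1 and 2k+2: either it fixes 2k and window k flips, or it
      -- exchanges 2k-1 and 2k and we move down to window k-1.
      descend : ∀ k → double (suc k) ≤ N → t (suc (double k)) ≡ double (suc k) →
                t (double (suc k)) ≡ suc (double k) → WindowFlips
      descend k bound e₁ e₂ with near (double k)
      ... | inj₁ e₀ = k , bound , windowParity-swap₁₂ {P} Q-injective k (via-t e₀) (via-t e₁) (via-t e₂)
      ... | inj₂ (inj₁ e₀) = ⊥-elim (m+1+n≢n 1 (t-injective (trans e₂ (sym e₀))))
      descend zero    bound e₁ e₂ | inj₂ (inj₂ ())
      descend (suc k) bound e₁ e₂ | inj₂ (inj₂ e₀) =
        descend k (≤-trans (n≤1+n _) (≤-trans (n≤1+n _) bound)) (swap-partner e₀′ t[2+p]≢1+p) e₀′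
        where
        e₀′ = suc-injective e₀
        t[2+p]≢1+p : t (suc (double (suc k))) ≢ double (suc k)
        t[2+p]≢1+p e = m+1+n≢n 1 (trans (sym e₁) e)

    fixes-all-or-flips-window : (∀ v → t v ≡ v) ⊎ WindowFlips
    fixes-all-or-flips-window with largest-moved N t-fixes
    ... | inj₁ t≗id = inj₁ t≗id
    ... | inj₂ (w , t[w]≢w , fixed) with largest-moved-swaps t[w]≢w fixed
    ... | p , refl , t[1+p]≡p , t[p]≡1+p with even-or-odd p
    ... | inj₁ (k , refl) = inj₂ (k , moved⇒<N t[w]≢w , flips)
      where flips = windowParity-swap₀₁ {P} Q-injective k (via-t t[p]≡1+p) (via-t t[1+p]≡p) (via-t (fixed ≤-refl))
    ... | inj₂ (k , refl) = inj₂ (descend k (<⇒≤ (moved⇒<N t[w]≢w)) t[p]≡1+p t[1+p]≡p)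

module _ {N : ℕ} where

  positions : Permutation′ N → ℕ → ℕ
  positions σ = extend (flip σ)

  -- The k-th bit compares the positions of the values 2k, 2k+1, 2k+2; when 2k+2 = N
  -- the missing value is placed, by the extension, after every position.
  colourBits : Permutation′ N → Fin (N / 2) → Bool
  colourBits σ = windowParity (positions σ) ∘ toℕ

  colour : Permutation′ N → Fin (2 ^ (N / 2))
  colour σ = funToFin (Inverse.from 2↔Bool ∘ colourBits σ)

  colour-windowParity : ∀ {σ π} → colour σ ≡ colour π → ∀ {k} → k < N / 2 →
                        windowParity (positions σ) k ≡ windowParity (positions π) k
  colour-windowParity {σ} {π} same {k} k<N/2 =
    subst (λ k → windowParity (positions σ) k ≡ windowParity (positions π) k) (toℕ-fromℕ< k<N/2)
      (trans (sym (bit σ)) (trans (cong (λ c → Inverse.to 2↔Bool (finToFun {2} c i)) same) (bit π)))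
    where
    i : Fin (N / 2)
    i = fromℕ< k<N/2
    bit : ∀ ρ → Inverse.to 2↔Bool (finToFun {2} (colour ρ) i) ≡ colourBits ρ i
    bit ρ = trans (cong (Inverse.to 2↔Bool) (finToFun-funToFin (Inverse.from 2↔Bool ∘ colourBits ρ) i))
                  (Inverse.strictlyInverseˡ 2↔Bool _)

  module _ (σ π : Permutation′ N) (close : chebyshev σ π ≤ 1) where

    private
      t s : ℕ → ℕ
      t = extend π ∘ positions σ
      s = extend σ ∘ positions π

      t∘s : ∀ v → t (s v) ≡ v
      t∘s v = trans (cong (extend π) (extend-flip-extend σ _)) (extend-extend-flip π v)

      s∘t : ∀ v → s (t v) ≡ v
      s∘t v = trans (cong (extend σ) (extend-flip-extend π _)) (extend-extend-flip σ v)

      t-fixes : ∀ {v} → N ≤ v → t v ≡ v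
      t-fixes N≤v = trans (cong (extend π) (extend-≥ (flip σ) N≤v)) (extend-≥ π N≤v)

      t-image : ∀ i → t (toℕ (σ ⟨$⟩ʳ i)) ≡ toℕ (π ⟨$⟩ʳ i)
      t-image i = begin
        extend π (extend (flip σ) (toℕ (σ ⟨$⟩ʳ i)))   ≡⟨ cong (extend π) (extend-toℕ (flip σ) _) ⟩
        extend π (toℕ (σ ⟨$⟩ˡ (σ ⟨$⟩ʳ i)))           ≡⟨ cong (extend π ∘ toℕ) (Perm.inverseˡ σ) ⟩
        extend π (toℕ i)                             ≡⟨ extend-toℕ π i ⟩
        toℕ (π ⟨$⟩ʳ i)                               ∎
        where open ≡-Reasoning

      t-near : ∀ v → ∣ t v - v ∣ ≤ 1
      t-near v with toℕ-or-≥ {N} v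
      ... | inj₁ (i , refl) =
        subst (λ i → ∣ t (toℕ i) - toℕ i ∣ ≤ 1) (Perm.inverseʳ σ)
          (subst (λ a → ∣ a - toℕ (σ ⟨$⟩ʳ j) ∣ ≤ 1) (sym (t-image j))
            (≤-trans (≤-chebyshev π σ j) (subst (_≤ 1) (chebyshev-comm σ π) close)))
        where j = σ ⟨$⟩ˡ i
      ... | inj₂ N≤v = subst (λ a → ∣ a - v ∣ ≤ 1) (sym (t-fixes N≤v)) (subst (_≤ 1) (sym (∣n-n∣≡0 v)) z≤n)

      Q-injective : Injective _≡_ _≡_ (positions π)
      Q-injective {u} {v} e = trans (sym (extend-extend-flip π u)) (trans (cong (extend π) e) (extend-extend-flip π v))

      P≗Q∘t : ∀ v → positions σ v ≡ positions π (t v)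
      P≗Q∘t v = sym (extend-flip-extend π _)

    colour-proper : colour σ ≡ colour π → σ Perm.≈ π
    colour-proper same with fixes-all-or-flips-window t∘s s∘t t-near t-fixes Q-injective P≗Q∘t
    ... | inj₁ t≗id = λ i → toℕ-injective (sym (trans (sym (t-image i)) (t≗id _)))
    ... | inj₂ (k , bound , flipped) = ⊥-elim (not-¬ (colour-windowParity same (double≤⇒≤/2 bound)) flipped)

  same-colour⇒far : ∀ {x y : Fin (N !)} → x ≢ y → colour (decode {N} x) ≡ colour (decode y) →
                    2 ≤ chebyshev (decode {N} x) (decode y)
  same-colour⇒far {x} {y} x≢y same with 2 ≤? chebyshev (decode {N} x) (decode y)
  ... | yes far  = far
  ... | no  ¬far = ⊥-elim (x≢y (decode-injective (colour-proper (decode x) (decode y) (≤-pred (≰⇒> ¬far)) same)))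

-- Some colour class is large

sumFin : ∀ K → (Fin K → ℕ) → ℕ
sumFin zero    f = 0
sumFin (suc K) f = f 0F + sumFin K (f ∘ Fin.suc)

sumFin-cong : ∀ K {f g : Fin K → ℕ} → f ≗ g → sumFin K f ≡ sumFin K g
sumFin-cong zero    f≗g = refl
sumFin-cong (suc K) f≗g = cong₂ _+_ (f≗g 0F) (sumFin-cong K (f≗g ∘ Fin.suc))

sumFin-+ : ∀ K (f g : Fin K → ℕ) → sumFin K (λ c → f c + g c) ≡ sumFin K f + sumFin K g
sumFin-+ zero    f g = refl
sumFin-+ (suc K) f g = trans (cong (f 0F + g 0F +_) (sumFin-+ K (f ∘ Fin.suc) (g ∘ Fin.suc)))
                             (interchange (f 0F) (g 0F) _ _)

sumFin-const : ∀ K n → sumFin K (λ _ → n) ≡ K * n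
sumFin-const zero    n = refl
sumFin-const (suc K) n = cong (n +_) (sumFin-const K n)

sumFin-≤ : ∀ K {f : Fin K → ℕ} {B} → (∀ c → f c ≤ B) → sumFin K f ≤ K * B
sumFin-≤ zero    f≤B = z≤n
sumFin-≤ (suc K) f≤B = +-mono-≤ (f≤B 0F) (sumFin-≤ K (f≤B ∘ Fin.suc))

δ : ∀ {K} → Fin K → Fin K → ℕ
δ a c = if does (a ≟ c) then 1 else 0

sumFin-δ : ∀ {K} (a : Fin K) → sumFin K (δ a) ≡ 1
sumFin-δ {suc K} 0F          = cong suc (sumFin-zeros K)
  where
  sumFin-zeros : ∀ K → sumFin K (δ {suc K} 0F ∘ Fin.suc) ≡ 0
  sumFin-zeros zero    = refl
  sumFin-zeros (suc K) = sumFin-zeros K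
sumFin-δ {suc K} (Fin.suc a) = sumFin-δ a

module _ {A : Set} {K : ℕ} (g : A → Fin K) where

  fibre : Fin K → List A → List A
  fibre c = filter (λ x → g x ≟ c)

  length-fibre-∷ : ∀ x xs c → length (fibre c (x ∷ xs)) ≡ δ (g x) c + length (fibre c xs)
  length-fibre-∷ x xs c with does (g x ≟ c)
  ... | true  = refl
  ... | false = refl

  sumFin-length-fibre : ∀ xs → sumFin K (λ c → length (fibre c xs)) ≡ length xs
  sumFin-length-fibre []       = trans (sumFin-const K 0) (*-zeroʳ K)
  sumFin-length-fibre (x ∷ xs) = begin
    sumFin K (λ c → length (fibre c (x ∷ xs)))                  ≡⟨ sumFin-cong K (length-fibre-∷ x xs) ⟩
    sumFin K (λ c → δ (g x) c + length (fibre c xs))            ≡⟨ sumFin-+ K (δ (g x)) _ ⟩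
    sumFin K (δ (g x)) + sumFin K (λ c → length (fibre c xs))   ≡⟨ cong₂ _+_ (sumFin-δ (g x)) (sumFin-length-fibre xs) ⟩
    suc (length xs)                                             ∎
    where open ≡-Reasoning

  large-fibre : .{{_ : NonZero K}} → ∀ xs → ∃ λ c → length xs / K ≤ length (fibre c xs)
  large-fibre xs with any? (λ c → length xs / K ≤? length (fibre c xs))
  ... | yes found = found
  ... | no  none  = ⊥-elim (n≮n L (≤-trans (+-monoˡ-≤ L (>-nonZero⁻¹ K)) K+L≤L))
    where
    open ≤-Reasoning
    L = length xs
    K+L≤L : K + L ≤ L
    K+L≤L = begin
      K + L                                                       ≡⟨ cong₂ _+_ K≡∑1 (sumFin-length-fibre xs) ⟨
      sumFin K (λ _ → 1) + sumFin K (λ c → length (fibre c xs))   ≡⟨ sumFin-+ K (λ _ → 1) _ ⟨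
      sumFin K (λ c → suc (length (fibre c xs)))                  ≤⟨ sumFin-≤ K (λ c → ≰⇒> (none ∘ (c ,_))) ⟩
      K * (L / K)                                                 ≡⟨ *-comm K (L / K) ⟩
      L / K * K                                                   ≤⟨ m/n*n≤m L K ⟩
      L                                                           ∎
      where K≡∑1 = trans (sumFin-const K 1) (*-identityʳ K)

m*n≤o⇒m≤o/n : ∀ {m n o} .{{_ : NonZero n}} → m * n ≤ o → m ≤ o / n
m*n≤o⇒m≤o/n {m} {n} m*n≤o = subst (_≤ _ / n) (m*n/n≡m m n) (/-monoˡ-≤ n m*n≤o)

length-take-≤ : ∀ {A : Set} n (xs : List A) → n ≤ length xs → length (take n xs) ≡ n
length-take-≤ n xs n≤|xs| = trans (length-take n xs) (m≤n⇒m⊓n≡m n≤|xs|)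

AllPairs-All-map : ∀ {A : Set} {P : A → Set} {R S : A → A → Set} → (∀ {x y} → P x → P y → R x y → S x y) →
                   ∀ {xs} → All P xs → AllPairs R xs → AllPairs S xs
AllPairs-All-map f []         []         = []
AllPairs-All-map f (px ∷ pxs) (rx ∷ rxs) =
  All.zipWith (λ (py , r) → f px py r) (pxs , rx) ∷ AllPairs-All-map f pxs rxs

module _ (N : ℕ) where

  private
    instance
      2^[N/2]-nonZero : NonZero (2 ^ (N / 2))
      2^[N/2]-nonZero = m^n≢0 2 (N / 2)

  code-bound : ∀ C → IsCode N 2 C → length C ≤ N ! / 2 ^ (N / 2)
  code-bound C code = m*n≤o⇒m≤o/n (length*2^m≤! (double[/2]≤ N) code)

  colour-class : Fin (2 ^ (N / 2)) → List (Fin (N !))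
  colour-class c = fibre (colour ∘ decode {N}) c (allFin (N !))

  colour-class-isCode : ∀ c → IsCode N 2 (map (decode {N}) (colour-class c))
  colour-class-isCode c = AllPairs.map⁺ (AllPairs-All-map far (all-filter c? (allFin (N !))) (AllPairs.filter⁺ c? (allFin⁺ (N !))))
    where
    c? = λ x → colour (decode {N} x) ≟ c
    far = λ {x y} x∈c y∈c x≢y → same-colour⇒far {N} {x} {y} x≢y (trans x∈c (sym y∈c))

  large-colour-class : ∃ λ c → N ! / 2 ^ (N / 2) ≤ length (colour-class c)
  large-colour-class = subst (λ L → ∃ λ c → L / 2 ^ (N / 2) ≤ length (colour-class c))
                             (length-tabulate id) (large-fibre (colour ∘ decode {N}) (allFin (N !)))

  large-code : ∃ λ C → IsCode N 2 C × length C ≡ N ! / 2 ^ (N / 2)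
  large-code = take q C , AllPairs.take⁺ q (colour-class-isCode c) , length-take-≤ q C q≤|C|
    where
    q = N ! / 2 ^ (N / 2)
    c = proj₁ large-colour-class
    C = map (decode {N}) (colour-class c)
    q≤|C| : q ≤ length C
    q≤|C| = subst (q ≤_) (sym (length-map (decode {N}) (colour-class c))) (proj₂ large-colour-class)

theorem7 : (n : ℕ) → IsP (suc n) 2 (_/_ ((suc n) !) (2 ^ (suc n / 2)) {{m^n≢0 2 (suc n / 2)}})
theorem7 n = large-code (suc n) , code-bound (suc n)
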